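{- Let $\varphi$ and $\psi$ be EPTC formulas. If the formula $\neg(\varphi\to\psi)$ is satisfiable, then it is satisfiable in a finite structure of pathwidth at most $\|\varphi\|-1$.
   Context: Fix a relational signature $\sigma$. EPTC (existential positive transitive closure logic) formulas: $\varphi ::= R\bar x\mid x=x'\mid\varphi\lor\varphi\mid\varphi\land\varphi\mid\exists x\,\varphi\mid[\varphi]^*_{\bar v\bar w}\bar x\bar y$ with $\bar x,\bar y,\bar v,\bar w$ of equal length $k\ge1$ and $\bar v\bar w$ pairwise distinct (no negation). Semantics is first-order, with $\mathfrak{A},I\models[\chi]^*_{\bar v\bar w}\bar x\bar y$ iff there are $n\ge0$ and $\bar a_0=I(\bar x),\dots,\bar a_n=I(\bar y)$ with $\mathfrak{A},I[\bar a_{i-1}\bar a_i/\bar v\bar w]\models\chi$ for $1\le i\le n$. $\|\varphi\|$ is the number of symbol occurrences in $\varphi$. A path decomposition of size $k$ of $\mathfrak{A}$ is a nonempty sequence of structures $\mathfrak{B}_0,\mathfrak{B}_1,\dots$ with at most $k$ elements each, whose universes cover $|\mathfrak{A}|$, whose relations union to those of $\mathfrak{A}$, and such that an element in $\mathfrak{B}_i$ and $\mathfrak{B}_j$ is in every $\mathfrak{B}_l$ with $l$ between $i$ and $j$; pathwidth is the minimum size minus one. -}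

module Defs where

open import Data.Nat using (ℕ; zero; suc; _+_; _≤_; _<_; _∸_; _≡ᵇ_)
open import Data.Bool using (if_then_else_)
open import Data.Fin using (Fin)
import Data.Fin as F
open import Data.Fin.Subset using (Subset; _∈_; ∣_∣)
open import Data.Vec using (Vec; []; _∷_; map; _++_; toList)
open import Data.Vec.Relation.Unary.All using (All)
open import Data.List.Relation.Unary.Unique.Propositional using (Unique)
open import Data.Product using (Σ; ∃; _×_)
open import Data.Sum using (_⊎_)
open import Relation.Binary.PropositionalEquality using (_≡_)
open import Relation.Nullary using (¬_)

record Signature : Set₁ where
  field
    Sym : Set
    ar  : Sym → ℕ
open Signature public

Var : Set
Var = ℕ

-- EPTC formulas. The transitive-closure operator [φ]*_{v w} x y carries
-- tuples of length k = suc k' ≥ 1, and a proof that v w are pairwise distinct.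
data Form (σ : Signature) : Set where
  atom : (R : Sym σ) → Vec Var (ar σ R) → Form σ
  eq   : Var → Var → Form σ
  _∨ᶠ_ : Form σ → Form σ → Form σ
  _∧ᶠ_ : Form σ → Form σ → Form σ
  ex   : Var → Form σ → Form σ
  tc   : (k : ℕ) → Form σ → (v w x y : Vec Var (suc k)) →
         Unique (toList (v ++ w)) → Form σ

size : ∀ {σ} → Form σ → ℕ
size {σ} (atom R xs) = suc (ar σ R)
size (eq x y) = 3
size (φ ∨ᶠ ψ) = suc (size φ + size ψ)
size (φ ∧ᶠ ψ) = suc (size φ + size ψ)
size (ex x φ) = 2 + size φ
size (tc k φ v w x y _) = 3 + size φ + 4 * suc k
  where open import Data.Nat using (_*_)

record Struct (σ : Signature) : Set₁ where
  field
    U   : Set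
    relᵁ : (R : Sym σ) → Vec U (ar σ R) → Set
open Struct public

update : ∀ {A : Set} {k} → (Var → A) → Vec Var k → Vec A k → (Var → A)
update I [] [] = I
update I (x ∷ v) (a ∷ as) y = if y ≡ᵇ x then a else update I v as y

Sat : ∀ {σ} (𝔄 : Struct σ) → (Var → U 𝔄) → Form σ → Set
Sat 𝔄 I (atom R xs) = relᵁ 𝔄 R (map I xs)
Sat 𝔄 I (eq x y) = I x ≡ I y
Sat 𝔄 I (φ ∨ᶠ ψ) = Sat 𝔄 I φ ⊎ Sat 𝔄 I ψ
Sat 𝔄 I (φ ∧ᶠ ψ) = Sat 𝔄 I φ × Sat 𝔄 I ψ
Sat 𝔄 I (ex x φ) = Σ (U 𝔄) λ a → Sat 𝔄 (update I (x ∷ []) (a ∷ [])) φ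
Sat 𝔄 I (tc k χ v w x y _) =
  Σ ℕ λ n → Σ (ℕ → Vec (U 𝔄) (suc k)) λ a →
    (a 0 ≡ map I x) × (a n ≡ map I y) ×
    (∀ i → i < n → Sat 𝔄 (update I (v ++ w) (a i ++ a (suc i))) χ)

FinStruct : Signature → ℕ → Set₁
FinStruct σ n = (R : Sym σ) → Vec (Fin n) (ar σ R) → Set

toStruct : ∀ {σ n} → FinStruct σ n → Struct σ
toStruct {σ} {n} B = record { U = Fin n ; relᵁ = B }

-- A path decomposition of size k of a finite structure 𝔅 (universe Fin n):
-- a nonempty sequence 𝔅_0 … 𝔅_len of structures, where 𝔅_i has universe
-- bag i ⊆ |𝔅| with at most k elements and relations brel i.
record PathDecomposition {σ n} (𝔅 : FinStruct σ n) (k : ℕ) : Set₁ where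
  field
    len     : ℕ
    bag     : Fin (suc len) → Subset n
    brel    : Fin (suc len) → (R : Sym σ) → Vec (Fin n) (ar σ R) → Set
    brel-in : ∀ i R ts → brel i R ts → All (_∈ bag i) ts
    small   : ∀ i → ∣ bag i ∣ ≤ k
    cover   : ∀ (a : Fin n) → ∃ λ i → a ∈ bag i
    union→  : ∀ R ts → 𝔅 R ts → ∃ λ i → brel i R ts
    union←  : ∀ R ts i → brel i R ts → 𝔅 R ts
    connect : ∀ (a : Fin n) (i j l : Fin (suc len)) → a ∈ bag i → a ∈ bag j →
              i F.≤ l → l F.≤ j → a ∈ bag l

PathwidthAtMost : ∀ {σ n} → FinStruct σ n → ℕ → Set₁
PathwidthAtMost 𝔅 w = PathDecomposition 𝔅 (suc w)

{-# OPTIONS --safe #-}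
-- EPTC formulas are preserved under homomorphisms, so it suffices to build from 𝔄, I ⊨ φ a finite
-- 𝔅 ⊨ φ of pathwidth below ‖φ‖ that maps homomorphically into 𝔄 compatibly with the assignments:
-- 𝔅 ⊨ ψ would then give 𝔄, I ⊨ ψ.
-- 𝔅 is read off a satisfaction proof of φ. Walking down φ, every witness of ∃ and every
-- intermediate tuple of a transitive closure becomes a fresh copy of its value in 𝔄, and every
-- quantifier and every step of a closure opens a new bag. A bag holds the copies of the free
-- variables of the current subformula and the elements still needed afterwards, at most ‖φ‖ of
-- them; a tuple is in a relation of 𝔅 if it lies in one bag and its values are related in 𝔄.
-- A new bag only contains elements of the previous one or fresh copies, so the bags form a path
-- decomposition. Equalities are enforced at the end by merging copies that share a bag, which
-- keeps the bags of each element contiguous.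
module Submission where

open import Defs
open import Data.Nat using (ℕ; _∸_)
open import Data.Fin using (Fin)
open import Data.Product using (Σ; _×_)
open import Relation.Nullary using (¬_)

open import Data.Bool using (true; false; if_then_else_)
open import Data.Empty using (⊥-elim)
open import Data.Fin using (toℕ; fromℕ<)
import Data.Fin.Properties as FP
open import Data.Fin.Subset using (Subset; ⁅_⁆; _∪_; ∣_∣) renaming (_∈_ to _∈ₛ_; ⊥ to ∅)
open import Data.Fin.Subset.Properties
  using (x∈p∪q⁺; x∈p∪q⁻; x∈⁅x⁆; x∈⁅y⁆⇒x≡y; ∣⊥∣≡0; ∣⁅x⁆∣≡1; ∉⊥)
open import Data.List as L using (List; []; _∷_; length)
open import Data.List.Extrema.Nat using (max; xs≤max)
import Data.List.Properties as LP
open import Data.List.Membership.Propositional using (_∈_; _∉_)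
open import Data.List.Membership.Propositional.Properties
  using (∈-++⁺ˡ; ∈-++⁺ʳ; ∈-++⁻; ∈-map⁺; ∈-map⁻; ∈-filter⁺; ∈-filter⁻)
open import Data.List.Relation.Binary.Permutation.Propositional.Properties using (++-comm)
open import Data.List.Relation.Binary.Subset.Propositional using (_⊆_)
open import Data.List.Relation.Binary.Subset.Propositional.Properties
  using (⊆-reflexive; ⊆-reflexive-↭; map⁺; ++⁺ʳ)
import Data.List.Relation.Unary.All as LA
open import Data.List.Relation.Unary.Any using (here; there)
open import Data.List.Relation.Unary.Unique.Propositional using (Unique)
open import Data.Nat using (zero; suc; _+_; _*_; _≤_; _<_; _≡ᵇ_; z≤n; s≤s; NonZero; >-nonZero)
open import Data.Nat.DivMod using (_mod_; m<n⇒m%n≡m)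
open import Data.Nat.Properties
open import Data.Nat.Tactic.RingSolver using (solve-∀)
open import Data.List.Membership.DecPropositional _≟_ using (_∈?_)
open import Data.Product using (_,_; proj₁; proj₂; ∃)
import Data.Product as Prod
open import Data.Sum as Sum using (_⊎_; inj₁; inj₂; [_,_]′)
open import Data.Vec as V using (Vec; []; _∷_; map; _++_; toList)
import Data.Vec.Properties as VP
import Data.Vec.Relation.Unary.All as VA
import Data.Vec.Relation.Unary.All.Properties as VAP
open import Function using (_∘_; id; case_of_)
open import Relation.Binary.PropositionalEquality
  using (_≡_; _≢_; refl; sym; trans; cong; cong₂; subst; module ≡-Reasoning)
open import Relation.Nullary using (Dec; yes; no; ¬?)

private
  variable
    A B : Set
    m : ℕ

update-∉ : (I : Var → A) (vs : Vec Var m) (as : Vec A m) {z : Var} →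
           z ∉ toList vs → update I vs as z ≡ I z
update-∉ I [] [] z∉ = refl
update-∉ I (x ∷ vs) (a ∷ as) {z} z∉ with z ≡ᵇ x | ≡ᵇ⇒≡ z x
... | true  | z≡x = ⊥-elim (z∉ (here (z≡x _)))
... | false | _   = update-∉ I vs as (z∉ ∘ there)

update-∈ : (I : Var → A) (vs : Vec Var m) (as : Vec A m) {z : Var} →
           z ∈ toList vs → update I vs as z ∈ toList as
update-∈ I (x ∷ vs) (a ∷ as) {z} z∈ with z ≡ᵇ x | ≡⇒≡ᵇ z x
... | true  | _   = here refl
... | false | z≢x with z∈
...   | here z≡x = ⊥-elim (z≢x z≡x)
...   | there z∈′ = there (update-∈ I vs as z∈′)

update-∈-irrelevant : (I I′ : Var → A) (vs : Vec Var m) (as : Vec A m) {z : Var} →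
                      z ∈ toList vs → update I vs as z ≡ update I′ vs as z
update-∈-irrelevant I I′ (x ∷ vs) (a ∷ as) {z} z∈ with z ≡ᵇ x | ≡⇒≡ᵇ z x
... | true  | _   = refl
... | false | z≢x with z∈
...   | here z≡x = ⊥-elim (z≢x z≡x)
...   | there z∈′ = update-∈-irrelevant I I′ vs as z∈′

update-∘ : (f : A → B) (I : Var → A) (vs : Vec Var m) (as : Vec A m) (z : Var) →
           f (update I vs as z) ≡ update (f ∘ I) vs (map f as) z
update-∘ f I [] [] z = refl
update-∘ f I (x ∷ vs) (a ∷ as) z with z ≡ᵇ x
... | true  = refl
... | false = update-∘ f I vs as z

infixl 5 _∖_
_∖_ : List Var → List Var → List Var
xs ∖ vs = L.filter (λ z → ¬? (z ∈? vs)) xs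

∈-∖⁺ : ∀ {z xs vs} → z ∈ xs → z ∉ vs → z ∈ xs ∖ vs
∈-∖⁺ = ∈-filter⁺ (λ z → ¬? (z ∈? _))

∈-∖⁻ : ∀ {z} xs vs → z ∈ xs ∖ vs → z ∈ xs × z ∉ vs
∈-∖⁻ xs vs = ∈-filter⁻ (λ z → ¬? (z ∈? vs))

update-agrees : (h : A → B) {I : Var → A} {I′ : Var → B} (vs : Vec Var m) (as : Vec A m) {xs : List Var} →
                (∀ {z} → z ∈ xs ∖ toList vs → h (I z) ≡ I′ z) →
                ∀ {z} → z ∈ xs → h (update I vs as z) ≡ update I′ vs (map h as) z
update-agrees h {I} {I′} vs as agree {z} z∈ with z ∈? toList vs
... | yes z∈vs = trans (update-∘ h I vs as z) (update-∈-irrelevant (h ∘ I) I′ vs (map h as) z∈vs)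
... | no  z∉vs = begin
  h (update I vs as z)            ≡⟨ cong h (update-∉ I vs as z∉vs) ⟩
  h (I z)                         ≡⟨ agree (∈-∖⁺ z∈ z∉vs) ⟩
  I′ z                            ≡⟨ update-∉ I′ vs (map h as) z∉vs ⟨
  update I′ vs (map h as) z       ∎
  where open ≡-Reasoning

∈-map-update⁻ : (J : Var → ℕ) (vs : Vec Var m) (es : Vec ℕ m) {xs : List Var} {e : ℕ} →
                e ∈ L.map (update J vs es) xs → e ∈ toList es ⊎ e ∈ L.map J (xs ∖ toList vs)
∈-map-update⁻ J vs es {xs} e∈ with ∈-map⁻ (update J vs es) e∈
... | z , z∈ , refl with z ∈? toList vs
...   | yes z∈vs = inj₁ (update-∈ J vs es z∈vs)
...   | no  z∉vs = inj₂ (subst (_∈ _) (sym (update-∉ J vs es z∉vs)) (∈-map⁺ J (∈-∖⁺ z∈ z∉vs)))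

map-∖-⊆-update : (J : Var → ℕ) (vs : Vec Var m) (es : Vec ℕ m) (xs : List Var) →
                 L.map J (xs ∖ toList vs) ⊆ L.map (update J vs es) xs
map-∖-⊆-update J vs es xs e∈ with ∈-map⁻ J e∈
... | z , z∈ , refl =
  let z∈xs , z∉vs = ∈-∖⁻ xs (toList vs) z∈ in
  subst (_∈ _) (update-∉ J vs es z∉vs) (∈-map⁺ (update J vs es) z∈xs)

fv : ∀ {σ} → Form σ → List Var
fv (atom R xs) = toList xs
fv (eq x y) = x ∷ y ∷ []
fv (φ ∨ᶠ ψ) = fv φ L.++ fv ψ
fv (φ ∧ᶠ ψ) = fv φ L.++ fv ψ
fv (ex x φ) = fv φ ∖ (x ∷ [])
fv (tc k χ v w x y _) = toList x L.++ toList y L.++ (fv χ ∖ toList (v ++ w))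

length-∖ : ∀ xs vs → length (xs ∖ vs) ≤ length xs
length-∖ xs vs = LP.length-filter (λ z → ¬? (z ∈? vs)) xs

length-fv≤size : ∀ {σ} (θ : Form σ) → length (fv θ) ≤ size θ
length-fv≤size (atom R xs) = ≤-trans (≤-reflexive (VP.length-toList xs)) (n≤1+n _)
length-fv≤size (eq x y) = s≤s (s≤s z≤n)
length-fv≤size (φ ∨ᶠ ψ) = ≤-trans (≤-reflexive (LP.length-++ (fv φ)))
  (m≤n⇒m≤1+n (+-mono-≤ (length-fv≤size φ) (length-fv≤size ψ)))
length-fv≤size (φ ∧ᶠ ψ) = ≤-trans (≤-reflexive (LP.length-++ (fv φ)))
  (m≤n⇒m≤1+n (+-mono-≤ (length-fv≤size φ) (length-fv≤size ψ)))
length-fv≤size (ex x φ) = ≤-trans (length-∖ (fv φ) _) (≤-trans (length-fv≤size φ) (m≤n+m _ 2))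
length-fv≤size (tc k χ v w x y _) = begin
  length (toList x L.++ toList y L.++ (fv χ ∖ toList (v ++ w)))
    ≡⟨ LP.length-++ (toList x) ⟩
  length (toList x) + length (toList y L.++ (fv χ ∖ toList (v ++ w)))
    ≡⟨ cong₂ _+_ (VP.length-toList x) (LP.length-++ (toList y)) ⟩
  suc k + (length (toList y) + length (fv χ ∖ toList (v ++ w)))
    ≤⟨ +-monoʳ-≤ (suc k) (+-mono-≤ (≤-reflexive (VP.length-toList y))
                                    (≤-trans (length-∖ (fv χ) _) (length-fv≤size χ))) ⟩
  suc k + (suc k + size χ)
    ≤⟨ ≤-trans (m≤m+n _ (3 + suc k + suc k)) (≤-reflexive (two-tuples-within (suc k) (size χ))) ⟩
  3 + size χ + 4 * suc k ∎
  where
  open ≤-Reasoning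
  two-tuples-within : ∀ K s → K + (K + s) + (3 + K + K) ≡ 3 + s + 4 * K
  two-tuples-within = solve-∀

-- Preservation under homomorphisms

map-agrees : {f g : A → B} (xs : Vec A m) → (∀ {z} → z ∈ toList xs → f z ≡ g z) → map f xs ≡ map g xs
map-agrees [] agree = refl
map-agrees (x ∷ xs) agree = cong₂ _∷_ (agree (here refl)) (map-agrees xs (agree ∘ there))

IsHom : ∀ {σ} (𝔄 𝔅 : Struct σ) → (U 𝔄 → U 𝔅) → Set
IsHom {σ} 𝔄 𝔅 h = ∀ R ts → relᵁ 𝔄 R ts → relᵁ 𝔅 R (map h ts)

module _ {σ : Signature} where

  -- Sat 𝔄 I (tc k χ v w x y _) unfolds to Walk 𝔄 I χ v w (map I x) (map I y).
  Walk : (𝔄 : Struct σ) (I : Var → U 𝔄) {k : ℕ} (χ : Form σ) (v w : Vec Var (suc k))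
         (b b′ : Vec (U 𝔄) (suc k)) → Set
  Walk 𝔄 I {k} χ v w b b′ =
    Σ ℕ λ n → Σ (ℕ → Vec (U 𝔄) (suc k)) λ a → (a 0 ≡ b) × (a n ≡ b′) ×
      (∀ i → i < n → Sat 𝔄 (update I (v ++ w) (a i ++ a (suc i))) χ)

  module Walks {k : ℕ} {χ : Form σ} {v w : Vec Var (suc k)} where

    walk-here : ∀ {𝔄 I b b′} → b ≡ b′ → Walk 𝔄 I χ v w b b′
    walk-here {b = b} b≡b′ = 0 , (λ _ → b) , refl , b≡b′ , λ _ ()

    walk-step : ∀ {𝔄 I b b′ b″} → Sat 𝔄 (update I (v ++ w) (b ++ b′)) χ →
                Walk 𝔄 I χ v w b′ b″ → Walk 𝔄 I χ v w b b″
    walk-step {𝔄} {I} {b} first (n , a , a0 , an , steps) = suc n , a′ , refl , an , steps′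
      where
      a′ : ℕ → Vec (U 𝔄) (suc k)
      a′ zero = b
      a′ (suc i) = a i
      steps′ : ∀ i → i < suc n → Sat 𝔄 (update I (v ++ w) (a′ i ++ a′ (suc i))) χ
      steps′ zero _ = subst (λ b′ → Sat 𝔄 (update I (v ++ w) (b ++ b′)) χ) (sym a0) first
      steps′ (suc i) (s≤s i<n) = steps i i<n

  Sat-hom : {𝔄 𝔅 : Struct σ} {h : U 𝔄 → U 𝔅} → IsHom 𝔄 𝔅 h →
            ∀ θ {I I′} → (∀ {z} → z ∈ fv θ → h (I z) ≡ I′ z) → Sat 𝔄 I θ → Sat 𝔅 I′ θ
  Sat-hom {𝔅 = 𝔅} {h} hom (atom R xs) {I} agree r =
    subst (relᵁ 𝔅 R) (trans (sym (VP.map-∘ h I xs)) (map-agrees xs agree)) (hom R _ r)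
  Sat-hom {h = h} hom (eq x y) agree x≡y =
    trans (sym (agree (here refl))) (trans (cong h x≡y) (agree (there (here refl))))
  Sat-hom hom (φ ∨ᶠ ψ) agree (inj₁ s) = inj₁ (Sat-hom hom φ (agree ∘ ∈-++⁺ˡ) s)
  Sat-hom hom (φ ∨ᶠ ψ) agree (inj₂ s) = inj₂ (Sat-hom hom ψ (agree ∘ ∈-++⁺ʳ (fv φ)) s)
  Sat-hom hom (φ ∧ᶠ ψ) agree (s , t) =
    Sat-hom hom φ (agree ∘ ∈-++⁺ˡ) s , Sat-hom hom ψ (agree ∘ ∈-++⁺ʳ (fv φ)) t
  Sat-hom {h = h} hom (ex x φ) agree (a , s) =
    h a , Sat-hom hom φ (update-agrees h (x ∷ []) (a ∷ []) agree) s
  Sat-hom {𝔅 = 𝔅} {h} hom (tc k χ v w x y _) {I} {I′} agree (n , a , a0 , an , steps) =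
    n , map h ∘ a , ends x a0 (agree ∘ ∈-++⁺ˡ) ,
    ends y an (agree ∘ ∈-++⁺ʳ (toList x) ∘ ∈-++⁺ˡ) , steps′
    where
    ends : ∀ xs {b} → b ≡ map I xs → (∀ {z} → z ∈ toList xs → h (I z) ≡ I′ z) →
           map h b ≡ map I′ xs
    ends xs refl agree′ = trans (sym (VP.map-∘ h I xs)) (map-agrees xs agree′)
    agree-body : ∀ {z} → z ∈ fv χ ∖ toList (v ++ w) → h (I z) ≡ I′ z
    agree-body = agree ∘ ∈-++⁺ʳ (toList x) ∘ ∈-++⁺ʳ (toList y)
    steps′ : ∀ i → i < n → Sat 𝔅 (update I′ (v ++ w) (map h (a i) ++ map h (a (suc i)))) χ
    steps′ i i<n = subst (λ b → Sat 𝔅 (update I′ (v ++ w) b) χ) (VP.map-++ h (a i) (a (suc i)))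
      (Sat-hom hom χ (update-agrees h (v ++ w) _ agree-body) (steps i i<n))

  Sat-cong : {𝔄 : Struct σ} → ∀ θ {I I′ : Var → U 𝔄} → (∀ z → I z ≡ I′ z) →
             Sat 𝔄 I θ → Sat 𝔄 I′ θ
  Sat-cong {𝔄} θ I≗I′ =
    Sat-hom (λ R ts r → subst (relᵁ 𝔄 R) (sym (VP.map-id ts)) r) θ (λ {z} _ → I≗I′ z)

Connected : ℕ → (ℕ → List A) → Set
Connected n B = ∀ {e i l j} → i ≤ l → l ≤ j → j ≤ n → e ∈ B i → e ∈ B j → e ∈ B l

≤-suc-cases : ∀ {t n} → t ≤ suc n → t ≤ n ⊎ t ≡ suc n
≤-suc-cases t≤ = Sum.map₁ ≤-pred (m≤n⇒m<n∨m≡n t≤)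

module _ {n : ℕ} {B B′ : ℕ → List A} (conn : Connected n B) (old : ∀ {t} → t ≤ n → B′ t ≡ B t) where
  private
    forth : ∀ {e t} → t ≤ n → e ∈ B′ t → e ∈ B t
    forth t≤n = subst (_ ∈_) (old t≤n)

    back : ∀ {e t} → t ≤ n → e ∈ B t → e ∈ B′ t
    back t≤n = subst (_ ∈_) (sym (old t≤n))

  connected-snoc : (∀ {e} → e ∈ B′ (suc n) → e ∈ B n ⊎ (∀ {t} → t ≤ n → e ∉ B t)) →
                   Connected (suc n) B′
  connected-snoc new {e} {i} {l} {j} i≤l l≤j j≤ e∈i e∈j
    with ≤-suc-cases (≤-trans l≤j j≤) | ≤-suc-cases j≤
  ... | inj₂ refl | inj₂ refl = e∈j
  ... | inj₂ refl | inj₁ j≤n  = ⊥-elim (<-irrefl refl (≤-trans l≤j j≤n))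
  ... | inj₁ l≤n  | inj₁ j≤n  = back l≤n (conn i≤l l≤j j≤n (forth i≤n e∈i) (forth j≤n e∈j))
    where i≤n = ≤-trans i≤l l≤n
  ... | inj₁ l≤n  | inj₂ refl = back l≤n (conn i≤l l≤n ≤-refl (forth i≤n e∈i) e∈Bn)
    where
    i≤n = ≤-trans i≤l l≤n
    e∈Bn = [ id , (λ e-new → ⊥-elim (e-new i≤n (forth i≤n e∈i))) ]′ (new e∈j)

connected-across : ∀ {n} {B : ℕ → List A} → Connected n B → ∀ {p q t} → t ≤ n → p ∈ B t → q ∈ B t →
                   ∀ {i l j} → i ≤ l → l ≤ j → j ≤ n → p ∈ B i → q ∈ B j → p ∈ B l ⊎ q ∈ B l
connected-across conn {t = t} t≤n p∈t q∈t {l = l} i≤l l≤j j≤n p∈i q∈j with ≤-total l t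
... | inj₁ l≤t = inj₁ (conn i≤l l≤t t≤n p∈i p∈t)
... | inj₂ t≤l = inj₂ (conn t≤l l≤j j≤n q∈t q∈j)

-- Two intervals sharing the bag t form an interval.
connected-pair : ∀ {n} {B : ℕ → List A} → Connected n B → ∀ {p q t} → t ≤ n → p ∈ B t → q ∈ B t →
                 ∀ {i l j} → i ≤ l → l ≤ j → j ≤ n →
                 p ∈ B i ⊎ q ∈ B i → p ∈ B j ⊎ q ∈ B j → p ∈ B l ⊎ q ∈ B l
connected-pair conn t≤n p∈t q∈t i≤l l≤j j≤n (inj₁ p∈i) (inj₁ p∈j) = inj₁ (conn i≤l l≤j j≤n p∈i p∈j)
connected-pair conn t≤n p∈t q∈t i≤l l≤j j≤n (inj₂ q∈i) (inj₂ q∈j) = inj₂ (conn i≤l l≤j j≤n q∈i q∈j)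
connected-pair conn t≤n p∈t q∈t i≤l l≤j j≤n (inj₁ p∈i) (inj₂ q∈j) =
  connected-across conn t≤n p∈t q∈t i≤l l≤j j≤n p∈i q∈j
connected-pair conn t≤n p∈t q∈t i≤l l≤j j≤n (inj₂ q∈i) (inj₁ p∈j) =
  Sum.swap (connected-across conn t≤n q∈t p∈t i≤l l≤j j≤n q∈i p∈j)

redirect : ℕ → ℕ → ℕ → ℕ
redirect e′ e t = if t ≡ᵇ e′ then e else t

redirect-source : ∀ e′ e → redirect e′ e e′ ≡ e
redirect-source e′ e with e′ ≡ᵇ e′ | ≡⇒≡ᵇ e′ e′ refl
... | true | _ = refl

redirect-other : ∀ {e′ e t} → t ≢ e′ → redirect e′ e t ≡ t
redirect-other {e′} {e} {t} t≢e′ with t ≡ᵇ e′ | ≡ᵇ⇒≡ t e′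
... | true  | t≡e′ = ⊥-elim (t≢e′ (t≡e′ _))
... | false | _    = refl

redirect-target : ∀ e′ e → redirect e′ e e ≡ e
redirect-target e′ e with e ≟ e′
... | yes refl = redirect-source e e
... | no  e≢e′ = redirect-other e≢e′

redirect-cases : ∀ e′ e t → (t ≡ e′ × redirect e′ e t ≡ e) ⊎ (t ≢ e′ × redirect e′ e t ≡ t)
redirect-cases e′ e t with t ≟ e′
... | yes refl = inj₁ (refl , redirect-source e′ e)
... | no  t≢e′ = inj₂ (t≢e′ , redirect-other t≢e′)

Redirected : ℕ → ℕ → ℕ → List ℕ → Set
Redirected e′ e x xs = (x ∈ xs × x ≢ e′) ⊎ (x ≡ e × (e ∈ xs ⊎ e′ ∈ xs))

∈-map-redirect⁻ : ∀ {e′ e x xs} → x ∈ L.map (redirect e′ e) xs → Redirected e′ e x xs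
∈-map-redirect⁻ {e′} {e} x∈ with ∈-map⁻ (redirect e′ e) x∈
... | t , t∈ , refl with redirect-cases e′ e t
...   | inj₁ (refl , ρt≡e) = inj₂ (ρt≡e , inj₂ t∈)
...   | inj₂ (t≢e′ , ρt≡t) rewrite ρt≡t = inj₁ (t∈ , t≢e′)

∈-map-redirect⁺ : ∀ {e′ e x xs} → Redirected e′ e x xs → x ∈ L.map (redirect e′ e) xs
∈-map-redirect⁺ {e′} {e} {xs = xs} = [ kept , merged ]′
  where
  hit : ∀ {t y} → t ∈ xs → redirect e′ e t ≡ y → y ∈ L.map (redirect e′ e) xs
  hit t∈ refl = ∈-map⁺ (redirect e′ e) t∈
  kept : ∀ {x} → x ∈ xs × x ≢ e′ → x ∈ L.map (redirect e′ e) xs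
  kept (x∈ , x≢e′) = hit x∈ (redirect-other x≢e′)
  merged : ∀ {x} → x ≡ e × (e ∈ xs ⊎ e′ ∈ xs) → x ∈ L.map (redirect e′ e) xs
  merged (refl , inj₁ e∈) = hit e∈ (redirect-target e′ e)
  merged (refl , inj₂ e′∈) = hit e′∈ (redirect-source e′ e)

connected-redirect : ∀ {n} {B : ℕ → List ℕ} → Connected n B →
                     ∀ {e e′ t} → t ≤ n → e ∈ B t → e′ ∈ B t → Connected n (L.map (redirect e′ e) ∘ B)
connected-redirect conn {e} {e′} t≤n e∈t e′∈t {x} i≤l l≤j j≤n x∈i x∈j with x ≟ e
... | yes refl =
  ∈-map-redirect⁺ (inj₂ (refl , connected-pair conn t≤n e∈t e′∈t i≤l l≤j j≤n (meets x∈i) (meets x∈j)))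
  where
  meets : ∀ {xs} → e ∈ L.map (redirect e′ e) xs → e ∈ xs ⊎ e′ ∈ xs
  meets e∈ = [ inj₁ ∘ proj₁ , proj₂ ]′ (∈-map-redirect⁻ e∈)
... | no x≢e with ∈-map-redirect⁻ x∈i | ∈-map-redirect⁻ x∈j
...   | inj₁ (x∈i′ , x≢e′) | inj₁ (x∈j′ , _) =
  ∈-map-redirect⁺ (inj₁ (conn i≤l l≤j j≤n x∈i′ x∈j′ , x≢e′))
...   | inj₂ (x≡e , _) | _ = ⊥-elim (x≢e x≡e)
...   | _ | inj₂ (x≡e , _) = ⊥-elim (x≢e x≡e)

∣p∪q∣≤∣p∣+∣q∣ : ∀ {n} (p q : Subset n) → ∣ p ∪ q ∣ ≤ ∣ p ∣ + ∣ q ∣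
∣p∪q∣≤∣p∣+∣q∣ [] [] = z≤n
∣p∪q∣≤∣p∣+∣q∣ (true ∷ p) (true ∷ q) =
  s≤s (≤-trans (∣p∪q∣≤∣p∣+∣q∣ p q) (+-monoʳ-≤ ∣ p ∣ (n≤1+n _)))
∣p∪q∣≤∣p∣+∣q∣ (true ∷ p) (false ∷ q) = s≤s (∣p∪q∣≤∣p∣+∣q∣ p q)
∣p∪q∣≤∣p∣+∣q∣ (false ∷ p) (true ∷ q) =
  ≤-trans (s≤s (∣p∪q∣≤∣p∣+∣q∣ p q)) (≤-reflexive (sym (+-suc _ _)))
∣p∪q∣≤∣p∣+∣q∣ (false ∷ p) (false ∷ q) = ∣p∪q∣≤∣p∣+∣q∣ p q

image : ∀ {n} → (A → Fin n) → List A → Subset n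
image f = L.foldr (λ a p → ⁅ f a ⁆ ∪ p) ∅

∣image∣≤length : ∀ {n} (f : A → Fin n) xs → ∣ image f xs ∣ ≤ length xs
∣image∣≤length {n = n} f [] = ≤-reflexive (∣⊥∣≡0 n)
∣image∣≤length f (a ∷ xs) = ≤-trans (∣p∪q∣≤∣p∣+∣q∣ ⁅ f a ⁆ (image f xs))
  (≤-trans (≤-reflexive (cong (_+ _) (∣⁅x⁆∣≡1 (f a)))) (s≤s (∣image∣≤length f xs)))

∈-image⁺ : ∀ {n} (f : A → Fin n) {a xs} → a ∈ xs → f a ∈ₛ image f xs
∈-image⁺ f {a} (here refl) = x∈p∪q⁺ (inj₁ (x∈⁅x⁆ (f a)))
∈-image⁺ f (there a∈) = x∈p∪q⁺ (inj₂ (∈-image⁺ f a∈))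

∈-image⁻ : ∀ {n} (f : A → Fin n) xs {y} → y ∈ₛ image f xs → ∃ λ a → a ∈ xs × y ≡ f a
∈-image⁻ f [] y∈ = ⊥-elim (∉⊥ y∈)
∈-image⁻ f (a ∷ xs) y∈ with x∈p∪q⁻ ⁅ f a ⁆ (image f xs) y∈
... | inj₁ y∈⁅fa⁆ = a , here refl , x∈⁅y⁆⇒x≡y (f a) y∈⁅fa⁆
... | inj₂ y∈′ = let b , b∈ , y≡fb = ∈-image⁻ f xs y∈′ in b , there b∈ , y≡fb

pairs : Vec A m → Vec B m → List (A × B)
pairs as bs = toList (V.zip as bs)

∈-pairs⁻ : ∀ (as : Vec A m) (bs : Vec B m) {a b} → (a , b) ∈ pairs as bs → a ∈ toList as × b ∈ toList bs
∈-pairs⁻ [] [] ()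
∈-pairs⁻ (a ∷ as) (b ∷ bs) (here refl) = here refl , here refl
∈-pairs⁻ (a ∷ as) (b ∷ bs) (there ab∈) = Prod.map there there (∈-pairs⁻ as bs ab∈)

pairs-map : (f : A → B) (as bs : Vec A m) → map f as ≡ map f bs →
            ∀ {a b} → (a , b) ∈ pairs as bs → f a ≡ f b
pairs-map f [] [] _ ()
pairs-map f (a ∷ as) (b ∷ bs) fas≡fbs (here refl) = VP.∷-injectiveˡ fas≡fbs
pairs-map f (a ∷ as) (b ∷ bs) fas≡fbs (there ab∈) = pairs-map f as bs (VP.∷-injectiveʳ fas≡fbs) ab∈

map-pairs : (f : A → B) (as bs : Vec A m) → (∀ {a b} → (a , b) ∈ pairs as bs → f a ≡ f b) →
            map f as ≡ map f bs
map-pairs f [] [] _ = refl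
map-pairs f (a ∷ as) (b ∷ bs) f≡ = cong₂ _∷_ (f≡ (here refl)) (map-pairs f as bs (f≡ ∘ there))

-- The unfolded structure

module Construction {σ : Signature} (𝔄 : Struct σ) (width : ℕ) where

  -- Elements are the numbers below fresh, each a copy of its value in 𝔄; the bags are
  -- bag 0, …, bag last; eqs lists the pairs of copies that still have to be identified.
  record Unfolding : Set where
    constructor mkUnfolding
    field
      fresh : ℕ
      val   : ℕ → U 𝔄
      last  : ℕ
      bag   : ℕ → List ℕ
      eqs   : List (ℕ × ℕ)
  open Unfolding

  lastBag : Unfolding → List ℕ
  lastBag u = bag u (last u)

  InBag : Unfolding → Vec ℕ m → Set
  InBag u ts = Σ ℕ λ t → t ≤ last u × toList ts ⊆ bag u t

  canonical : Unfolding → Struct σ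
  canonical u = record { U = ℕ ; relᵁ = λ R ts → InBag u ts × relᵁ 𝔄 R (map (val u) ts) }

  record Respects (u : Unfolding) (ℌ : Struct σ) (f : ℕ → U ℌ) : Set where
    field
      hom        : IsHom (canonical u) ℌ f
      identifies : ∀ {a b} → (a , b) ∈ eqs u → f a ≡ f b
  open Respects

  -- Equalities are only enforced at the very end, so what an unfolding guarantees is stated
  -- for every image of its canonical structure that identifies the pending pairs.
  Forces : Unfolding → (Var → ℕ) → Form σ → Set₁
  Forces u J θ = ∀ ℌ f → Respects u ℌ f → Sat ℌ (f ∘ J) θ

  record WellFormed (u : Unfolding) : Set where
    field
      bounded   : ∀ {t e} → t ≤ last u → e ∈ bag u t → e < fresh u
      small     : ∀ {t} → t ≤ last u → length (bag u t) ≤ suc width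
      connected : Connected (last u) (bag u)
      eqs-sound : ∀ {a b} → (a , b) ∈ eqs u → val u a ≡ val u b × InBag u (a ∷ b ∷ [])
  open WellFormed

  record _⊑_ (u u′ : Unfolding) : Set where
    field
      fresh-≤ : fresh u ≤ fresh u′
      val-≡   : ∀ {e} → e < fresh u → val u′ e ≡ val u e
      last-≤  : last u ≤ last u′
      bag-≡   : ∀ {t} → t ≤ last u → bag u′ t ≡ bag u t
      eqs-⊆   : eqs u ⊆ eqs u′
  open _⊑_

  ⊑-refl : ∀ {u} → u ⊑ u
  ⊑-refl = record
    { fresh-≤ = ≤-refl ; val-≡ = λ _ → refl ; last-≤ = ≤-refl ; bag-≡ = λ _ → refl ; eqs-⊆ = id }

  ⊑-trans : ∀ {u₁ u₂ u₃} → u₁ ⊑ u₂ → u₂ ⊑ u₃ → u₁ ⊑ u₃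
  ⊑-trans ext ext′ = record
    { fresh-≤ = ≤-trans (fresh-≤ ext) (fresh-≤ ext′)
    ; val-≡   = λ e< → trans (val-≡ ext′ (<-≤-trans e< (fresh-≤ ext))) (val-≡ ext e<)
    ; last-≤  = ≤-trans (last-≤ ext) (last-≤ ext′)
    ; bag-≡   = λ t≤ → trans (bag-≡ ext′ (≤-trans t≤ (last-≤ ext))) (bag-≡ ext t≤)
    ; eqs-⊆   = eqs-⊆ ext′ ∘ eqs-⊆ ext
    }

  lastBag-bounded : ∀ {u} → WellFormed u → ∀ {e} → e ∈ lastBag u → e < fresh u
  lastBag-bounded wf = bounded wf ≤-refl

  val-lastBag : ∀ {u u′} → WellFormed u → u ⊑ u′ → ∀ {e} → e ∈ lastBag u → val u′ e ≡ val u e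
  val-lastBag wf ext = val-≡ ext ∘ lastBag-bounded wf

  InBag-⊑ : ∀ {u u′} → u ⊑ u′ → {ts : Vec ℕ m} → InBag u ts → InBag u′ ts
  InBag-⊑ ext (t , t≤ , ts⊆) = t , ≤-trans t≤ (last-≤ ext) , subst (_ ⊆_) (sym (bag-≡ ext t≤)) ts⊆

  Respects-⊑ : ∀ {u u′ ℌ f} → WellFormed u → u ⊑ u′ → Respects u′ ℌ f → Respects u ℌ f
  Respects-⊑ {u} {u′} wf ext resp = record
    { hom = λ R ts (inBag@(t , t≤ , ts⊆) , r) →
        hom resp R ts (InBag-⊑ ext inBag ,
          subst (relᵁ 𝔄 R) (map-agrees ts (λ e∈ → sym (val-≡ ext (bounded wf t≤ (ts⊆ e∈))))) r)
    ; identifies = identifies resp ∘ eqs-⊆ ext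
    }

  Forces-⊑ : ∀ {u u′ J θ} → WellFormed u → u ⊑ u′ → Forces u J θ → Forces u′ J θ
  Forces-⊑ wf ext forces ℌ f = forces ℌ f ∘ Respects-⊑ wf ext

  Forces-update : ∀ {u J θ} (vs : Vec Var m) (es : Vec ℕ m) → Forces u (update J vs es) θ →
                  ∀ {ℌ f} → Respects u ℌ f → Sat ℌ (update (f ∘ J) vs (map f es)) θ
  Forces-update {J = J} {θ} vs es forces {ℌ} {f} resp =
    Sat-cong θ (update-∘ f J vs es) (forces ℌ f resp)

  Fresh : Unfolding → ℕ → Set
  Fresh u e = ∀ {t} → t ≤ last u → e ∉ bag u t

  beyond-fresh : ∀ {u} → WellFormed u → ∀ {e} → fresh u ≤ e → Fresh u e
  beyond-fresh wf f≤e t≤ e∈ = <-irrefl refl (<-≤-trans (bounded wf t≤ e∈) f≤e)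

  Admissible : Unfolding → ℕ → Set
  Admissible u e = (e ∈ lastBag u ⊎ Fresh u e) × e < fresh u

  lastBag-admissible : ∀ {u} → WellFormed u → ∀ {e} → e ∈ lastBag u → Admissible u e
  lastBag-admissible wf e∈ = inj₁ e∈ , lastBag-bounded wf e∈

  set : (ℕ → U 𝔄) → ℕ → U 𝔄 → ℕ → U 𝔄
  set h c a e = if e ≡ᵇ c then a else h e

  set-at : ∀ h c a → set h c a c ≡ a
  set-at h c a with c ≡ᵇ c | ≡⇒≡ᵇ c c refl
  ... | true | _ = refl

  set-below : ∀ h {c} a {e} → e < c → set h c a e ≡ h e
  set-below h {c} a {e} e<c with e ≡ᵇ c | ≡ᵇ⇒≡ e c
  ... | true  | e≡c = ⊥-elim (<-irrefl (e≡c _) e<c)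
  ... | false | _   = refl

  extendVal : (ℕ → U 𝔄) → ℕ → Vec (U 𝔄) m → ℕ → U 𝔄
  extendVal h c [] = h
  extendVal h c (a ∷ as) = extendVal (set h c a) (suc c) as

  block : ℕ → Vec A m → Vec ℕ m
  block c [] = []
  block c (_ ∷ as) = c ∷ block (suc c) as

  extendVal-below : ∀ h {c} (as : Vec (U 𝔄) m) {e} → e < c → extendVal h c as e ≡ h e
  extendVal-below h [] e<c = refl
  extendVal-below h (a ∷ as) e<c =
    trans (extendVal-below (set h _ a) as (m<n⇒m<1+n e<c)) (set-below h a e<c)

  extendVal-block : ∀ h c (as : Vec (U 𝔄) m) → map (extendVal h c as) (block c as) ≡ as
  extendVal-block h c [] = refl
  extendVal-block h c (a ∷ as) =
    cong₂ _∷_ (trans (extendVal-below (set h c a) as (n<1+n c)) (set-at h c a))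
              (extendVal-block (set h c a) (suc c) as)

  ∈-block : ∀ c (as : Vec A m) {e} → e ∈ toList (block c as) → c ≤ e × e < c + m
  ∈-block c (a ∷ as) (here refl) = ≤-refl , m<m+n c (s≤s z≤n)
  ∈-block {m = suc n} c (a ∷ as) {e} (there e∈) =
    let c<e , e< = ∈-block (suc c) as e∈ in <⇒≤ c<e , subst (e <_) (sym (+-suc c n)) e<

  adjoin : Unfolding → Vec (U 𝔄) m → Unfolding
  adjoin {m} u as = record u { fresh = fresh u + m ; val = extendVal (val u) (fresh u) as }

  newBlock : Unfolding → Vec (U 𝔄) m → Vec ℕ m
  newBlock u = block (fresh u)

  adjoin-⊑ : ∀ u (as : Vec (U 𝔄) m) → u ⊑ adjoin u as
  adjoin-⊑ u as = record
    { fresh-≤ = m≤m+n _ _ ; val-≡ = extendVal-below (val u) as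
    ; last-≤ = ≤-refl ; bag-≡ = λ _ → refl ; eqs-⊆ = id
    }

  adjoin-wf : ∀ {u} (as : Vec (U 𝔄) m) → WellFormed u → WellFormed (adjoin u as)
  adjoin-wf {u = u} as wf = record
    { bounded = λ t≤ e∈ → <-≤-trans (bounded wf t≤ e∈) (m≤m+n _ _)
    ; small = small wf
    ; connected = connected wf
    ; eqs-sound = λ ab∈ →
        let va≡vb , inBag@(t , t≤ , ab⊆) = eqs-sound wf ab∈
            kept : ∀ {e} → e ∈ bag u t → val (adjoin u as) e ≡ val u e
            kept = val-≡ (adjoin-⊑ u as) ∘ bounded wf t≤
        in trans (kept (ab⊆ (here refl))) (trans va≡vb (sym (kept (ab⊆ (there (here refl)))))) , inBag
    }

  newBlock-val : ∀ u (as : Vec (U 𝔄) m) → map (val (adjoin u as)) (newBlock u as) ≡ as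
  newBlock-val u = extendVal-block (val u) (fresh u)

  newBlock-admissible : ∀ {u} → WellFormed u → (as : Vec (U 𝔄) m) →
                        ∀ {e} → e ∈ toList (newBlock u as) → Admissible (adjoin u as) e
  newBlock-admissible wf as e∈ = let f≤e , e< = ∈-block _ as e∈ in inj₂ (beyond-fresh wf f≤e) , e<

  push : Unfolding → List ℕ → Unfolding
  push u b = record u { last = suc (last u) ; bag = λ t → if t ≡ᵇ suc (last u) then b else bag u t }

  push-lastBag : ∀ u b → lastBag (push u b) ≡ b
  push-lastBag u b with suc (last u) ≡ᵇ suc (last u) | ≡⇒≡ᵇ (suc (last u)) (suc (last u)) refl
  ... | true | _ = refl

  push-bag : ∀ u b {t} → t ≤ last u → bag (push u b) t ≡ bag u t
  push-bag u b {t} t≤ with t ≡ᵇ suc (last u) | ≡ᵇ⇒≡ t (suc (last u))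
  ... | true  | t≡ = ⊥-elim (<-irrefl (t≡ _) (s≤s t≤))
  ... | false | _  = refl

  push-bag-cases : ∀ u b {t} → t ≤ suc (last u) →
                   (t ≤ last u × bag (push u b) t ≡ bag u t) ⊎ bag (push u b) t ≡ b
  push-bag-cases u b t≤ with ≤-suc-cases t≤
  ... | inj₁ t≤n = inj₁ (t≤n , push-bag u b t≤n)
  ... | inj₂ refl = inj₂ (push-lastBag u b)

  push-⊑ : ∀ u b → u ⊑ push u b
  push-⊑ u b = record
    { fresh-≤ = ≤-refl ; val-≡ = λ _ → refl ; last-≤ = n≤1+n _ ; bag-≡ = push-bag u b ; eqs-⊆ = id }

  push-wf : ∀ {u b} → WellFormed u → (∀ {e} → e ∈ b → Admissible u e) → length b ≤ suc width →
            WellFormed (push u b)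
  push-wf {u} {b} wf b-admissible b-small = record
    { bounded = λ t≤ e∈ → [ (λ (t≤n , b≡) → bounded wf t≤n (subst (_ ∈_) b≡ e∈))
                          , (λ b≡ → proj₂ (b-admissible (subst (_ ∈_) b≡ e∈))) ]′ (push-bag-cases u b t≤)
    ; small = λ t≤ → [ (λ (t≤n , b≡) → subst (λ B → length B ≤ suc width) (sym b≡) (small wf t≤n))
                     , (λ b≡ → subst (λ B → length B ≤ suc width) (sym b≡) b-small) ]′ (push-bag-cases u b t≤)
    ; connected = connected-snoc (connected wf) (push-bag u b)
                    (proj₁ ∘ b-admissible ∘ subst (_ ∈_) (push-lastBag u b))
    ; eqs-sound = Prod.map₂ (InBag-⊑ (push-⊑ u b)) ∘ eqs-sound wf
    }

  assume : Unfolding → List (ℕ × ℕ) → Unfolding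
  assume u ps = record u { eqs = ps L.++ eqs u }

  assume-⊑ : ∀ u ps → u ⊑ assume u ps
  assume-⊑ u ps = record
    { fresh-≤ = ≤-refl ; val-≡ = λ _ → refl ; last-≤ = ≤-refl ; bag-≡ = λ _ → refl ; eqs-⊆ = ∈-++⁺ʳ ps }

  assume-wf : ∀ {u ps} → WellFormed u →
              (∀ {a b} → (a , b) ∈ ps → val u a ≡ val u b × a ∈ lastBag u × b ∈ lastBag u) →
              WellFormed (assume u ps)
  assume-wf {u} {ps} wf ps-sound = record
    { bounded = bounded wf ; small = small wf ; connected = connected wf
    ; eqs-sound = λ ab∈ → [ sound-new , eqs-sound wf ]′ (∈-++⁻ ps ab∈)
    }
    where
    sound-new : ∀ {a b} → (a , b) ∈ ps → val u a ≡ val u b × InBag u (a ∷ b ∷ [])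
    sound-new ab∈ with ps-sound ab∈
    ... | va≡vb , a∈ , b∈ = va≡vb , last u , ≤-refl , λ { (here refl) → a∈ ; (there (here refl)) → b∈ }

  frame : List ℕ → (Var → ℕ) → Form σ → List ℕ
  frame S J θ = S L.++ L.map J (fv θ)

  length-frame : ∀ S J θ → length (frame S J θ) ≤ length S + size θ
  length-frame S J θ = begin
    length (S L.++ L.map J (fv θ))      ≡⟨ LP.length-++ S ⟩
    length S + length (L.map J (fv θ))  ≡⟨ cong (length S +_) (LP.length-map J (fv θ)) ⟩
    length S + length (fv θ)            ≤⟨ +-monoʳ-≤ (length S) (length-fv≤size θ) ⟩
    length S + size θ                   ∎
    where open ≤-Reasoning

  -- S collects the elements that the rest of the formula still needs after θ.
  record Ready (u : Unfolding) (I : Var → U 𝔄) (J : Var → ℕ) (S : List ℕ) (θ : Form σ) : Set where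
    field
      agrees : ∀ {z} → z ∈ fv θ → val u (J z) ≡ I z
      framed : frame S J θ ⊆ lastBag u
      fits   : length S + size θ ≤ suc width

    stacked : S ⊆ lastBag u
    stacked = framed ∘ ∈-++⁺ˡ

    placed : ∀ {z} → z ∈ fv θ → J z ∈ lastBag u
    placed = framed ∘ ∈-++⁺ʳ S ∘ ∈-map⁺ J

    placed-tuple : (xs : Vec Var m) → toList xs ⊆ fv θ → toList (map J xs) ⊆ lastBag u
    placed-tuple xs xs⊆ = framed ∘ ∈-++⁺ʳ S ∘ map⁺ J xs⊆ ∘ subst (_ ∈_) (VP.toList-map J xs)

    agrees-tuple : (xs : Vec Var m) → toList xs ⊆ fv θ → map (val u) (map J xs) ≡ map I xs
    agrees-tuple xs xs⊆ = trans (sym (VP.map-∘ (val u) J xs)) (map-agrees xs (agrees ∘ xs⊆))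
  open Ready

  Ready-⊑ : ∀ {u u′ I J S θ} → WellFormed u → u ⊑ u′ → Ready u I J S θ → frame S J θ ⊆ lastBag u′ →
            Ready u′ I J S θ
  Ready-⊑ wf ext ready framed′ = record
    { agrees = λ z∈ → trans (val-lastBag wf ext (placed ready z∈)) (agrees ready z∈)
    ; framed = framed′
    ; fits = fits ready
    }

  record Grown (u : Unfolding) (keep : List ℕ) (P : Unfolding → Set₁) : Set₁ where
    field
      result    : Unfolding
      result-wf : WellFormed result
      extends   : u ⊑ result
      keeps     : keep ⊆ lastBag result
      ensures   : P result
  open Grown

  Grown-map : ∀ {u K K′} {P Q : Unfolding → Set₁} → K′ ⊆ K → (∀ {r} → P r → Q r) →
              Grown u K P → Grown u K′ Q
  Grown-map K′⊆K P⇒Q g = record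
    { result = result g ; result-wf = result-wf g ; extends = extends g
    ; keeps = keeps g ∘ K′⊆K ; ensures = P⇒Q (ensures g)
    }

  Grown-⊑ : ∀ {u u′ K P} → u ⊑ u′ → Grown u′ K P → Grown u K P
  Grown-⊑ ext g = record
    { result = result g ; result-wf = result-wf g ; extends = ⊑-trans ext (extends g)
    ; keeps = keeps g ; ensures = ensures g
    }

  Unfolder : Form σ → Set₁
  Unfolder θ = ∀ {I u J S} → Sat 𝔄 I θ → WellFormed u → Ready u I J S θ →
               Grown u (frame S J θ) (λ r → Forces r J θ)

  unfold-atom : ∀ R xs → Unfolder (atom R xs)
  unfold-atom R xs {I} {u} {J} sat wf ready = record
    { result = u ; result-wf = wf ; extends = ⊑-refl ; keeps = framed ready
    ; ensures = λ ℌ f resp →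
        subst (relᵁ ℌ R) (sym (VP.map-∘ f J xs)) (hom resp R (map J xs) (inBag , holds))
    }
    where
    inBag : InBag u (map J xs)
    inBag = last u , ≤-refl , placed-tuple ready xs id
    holds : relᵁ 𝔄 R (map (val u) (map J xs))
    holds = subst (relᵁ 𝔄 R) (sym (agrees-tuple ready xs id)) sat

  unfold-eq : ∀ x y → Unfolder (eq x y)
  unfold-eq x y {I} {u} {J} sat wf ready = record
    { result = assume u ((J x , J y) ∷ []) ; result-wf = assume-wf wf sound ; extends = assume-⊑ u _
    ; keeps = framed ready ; ensures = λ ℌ f resp → identifies resp (here refl)
    }
    where
    sound : ∀ {a b} → (a , b) ∈ (J x , J y) ∷ [] → val u a ≡ val u b × a ∈ lastBag u × b ∈ lastBag u
    sound (here refl) =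
      trans (agrees ready (here refl)) (trans sat (sym (agrees ready (there (here refl))))) ,
      placed ready (here refl) , placed ready (there (here refl))

  unfold-part : ∀ {θ θ′} → Unfolder θ → (ys : List Var) → fv θ′ ⊆ ys L.++ fv θ → ys L.++ fv θ ⊆ fv θ′ →
                length ys + size θ ≤ size θ′ →
                ∀ {I u J S} → Sat 𝔄 I θ → WellFormed u → Ready u I J S θ′ →
                Grown u (frame S J θ′) (λ r → Forces r J θ)
  unfold-part {θ} {θ′} unfold ys covers within fits′ {I} {u} {J} {S} sat wf ready =
    Grown-map reframe id (unfold sat wf ready′)
    where
    S′ = S L.++ L.map J ys
    regroup : S L.++ L.map J (ys L.++ fv θ) ≡ frame S′ J θ
    regroup = trans (cong (S L.++_) (LP.map-++ J ys (fv θ))) (sym (LP.++-assoc S _ _))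
    reframe : frame S J θ′ ⊆ frame S′ J θ
    reframe = subst (_ ∈_) regroup ∘ ++⁺ʳ S (map⁺ J covers)
    unframe : frame S′ J θ ⊆ frame S J θ′
    unframe = ++⁺ʳ S (map⁺ J within) ∘ subst (_ ∈_) (sym regroup)
    fits″ : length S′ + size θ ≤ suc width
    fits″ = begin
      length S′ + size θ               ≡⟨ cong (_+ size θ) (LP.length-++ S) ⟩
      length S + length (L.map J ys) + size θ
                                       ≡⟨ cong (λ n → length S + n + size θ) (LP.length-map J ys) ⟩
      length S + length ys + size θ    ≡⟨ +-assoc (length S) _ _ ⟩
      length S + (length ys + size θ)  ≤⟨ +-monoʳ-≤ (length S) fits′ ⟩
      length S + size θ′               ≤⟨ fits ready ⟩
      suc width                        ∎
      where open ≤-Reasoning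
    ready′ : Ready u I J S′ θ
    ready′ = record
      { agrees = agrees ready ∘ within ∘ ∈-++⁺ʳ ys ; framed = framed ready ∘ unframe ; fits = fits″ }

  fits-left : ∀ (θ₁ θ₂ : Form σ) → length (fv θ₂) + size θ₁ ≤ suc (size θ₁ + size θ₂)
  fits-left θ₁ θ₂ =
    m≤n⇒m≤1+n (≤-trans (+-monoˡ-≤ (size θ₁) (length-fv≤size θ₂))
                       (≤-reflexive (+-comm (size θ₂) (size θ₁))))

  fits-right : ∀ (θ₁ θ₂ : Form σ) → length (fv θ₁) + size θ₂ ≤ suc (size θ₁ + size θ₂)
  fits-right θ₁ θ₂ = m≤n⇒m≤1+n (+-monoˡ-≤ (size θ₂) (length-fv≤size θ₁))

  ++-swap : ∀ (xs ys : List Var) → xs L.++ ys ⊆ ys L.++ xs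
  ++-swap xs ys = ⊆-reflexive-↭ (++-comm xs ys)

  unfold-∨ : ∀ {θ₁ θ₂} → Unfolder θ₁ → Unfolder θ₂ → Unfolder (θ₁ ∨ᶠ θ₂)
  unfold-∨ {θ₁} {θ₂} unfold₁ unfold₂ (inj₁ sat) wf ready =
    Grown-map id (λ forces ℌ f → inj₁ ∘ forces ℌ f)
      (unfold-part {θ₁} {θ₁ ∨ᶠ θ₂} unfold₁ (fv θ₂) (++-swap (fv θ₁) _) (++-swap (fv θ₂) _)
         (fits-left θ₁ θ₂) sat wf ready)
  unfold-∨ {θ₁} {θ₂} unfold₁ unfold₂ (inj₂ sat) wf ready =
    Grown-map id (λ forces ℌ f → inj₂ ∘ forces ℌ f)
      (unfold-part {θ₂} {θ₁ ∨ᶠ θ₂} unfold₂ (fv θ₁) id id (fits-right θ₁ θ₂) sat wf ready)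

  unfold-∧ : ∀ {θ₁ θ₂} → Unfolder θ₁ → Unfolder θ₂ → Unfolder (θ₁ ∧ᶠ θ₂)
  unfold-∧ {θ₁} {θ₂} unfold₁ unfold₂ (sat₁ , sat₂) wf ready = record
    { result = result g₂ ; result-wf = result-wf g₂ ; extends = ⊑-trans (extends g₁) (extends g₂)
    ; keeps = keeps g₂
    ; ensures = λ ℌ f resp →
        Forces-⊑ {θ = θ₁} (result-wf g₁) (extends g₂) (ensures g₁) ℌ f resp , ensures g₂ ℌ f resp
    }
    where
    g₁ = unfold-part {θ₁} {θ₁ ∧ᶠ θ₂} unfold₁ (fv θ₂) (++-swap (fv θ₁) _) (++-swap (fv θ₂) _)
           (fits-left θ₁ θ₂) sat₁ wf ready
    g₂ = unfold-part {θ₂} {θ₁ ∧ᶠ θ₂} unfold₂ (fv θ₁) id id (fits-right θ₁ θ₂) sat₂ (result-wf g₁)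
           (Ready-⊑ wf (extends g₁) ready (keeps g₁))

  descend : ∀ {θ} → Unfolder θ → ∀ {I u J S} (vs : Vec Var m) (es : Vec ℕ m) {as : Vec (U 𝔄) m} →
            Sat 𝔄 (update I vs as) θ → WellFormed u → map (val u) es ≡ as →
            (∀ {e} → e ∈ S → e ∈ lastBag u ⊎ e ∈ toList es) →
            (∀ {e} → e ∈ toList es → Admissible u e) →
            (∀ {z} → z ∈ fv θ ∖ toList vs → J z ∈ lastBag u × val u (J z) ≡ I z) →
            length S + size θ ≤ suc width →
            Grown u (frame S (update J vs es) θ) (λ r → Forces r (update J vs es) θ)
  descend {θ = θ} unfold {I} {u} {J} {S} vs es {as} sat wf es-val stack new outside fits′ =
    Grown-⊑ (push-⊑ u b) (unfold sat (push-wf wf admissible (≤-trans (length-frame S _ θ) fits′)) ready)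
    where
    b = frame S (update J vs es) θ
    admissible : ∀ {e} → e ∈ b → Admissible u e
    admissible e∈ with ∈-++⁻ S e∈
    ... | inj₁ e∈S = [ lastBag-admissible wf , new ]′ (stack e∈S)
    ... | inj₂ e∈J′ with ∈-map-update⁻ J vs es e∈J′
    ...   | inj₁ e∈es = new e∈es
    ...   | inj₂ e∈J with ∈-map⁻ J e∈J
    ...     | z , z∈ , refl = lastBag-admissible wf (proj₁ (outside z∈))
    ready : Ready (push u b) (update I vs as) (update J vs es) S θ
    ready = record
      { agrees = λ z∈ → trans (update-agrees (val u) vs es (proj₂ ∘ outside) z∈)
                              (cong (λ bs → update I vs bs _) es-val)
      ; framed = ⊆-reflexive (sym (push-lastBag u b))
      ; fits = fits′
      }

  unfold-ex : ∀ x {θ} → Unfolder θ → Unfolder (ex x θ)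
  unfold-ex x {θ} unfold {I} {u} {J} {S} (a , sat) wf ready =
    Grown-map (++⁺ʳ S (map-∖-⊆-update J (x ∷ []) es (fv θ)))
              (λ forces ℌ f → (f (fresh u) ,_) ∘ Forces-update {J = J} {θ} (x ∷ []) es forces)
              (Grown-⊑ (adjoin-⊑ u (a ∷ [])) g)
    where
    es = newBlock u (a ∷ [])
    g = descend unfold (x ∷ []) es sat (adjoin-wf (a ∷ []) wf) (newBlock-val u (a ∷ []))
          (inj₁ ∘ stacked ready) (newBlock-admissible wf (a ∷ []))
          (λ z∈ → placed ready z∈ ,
                  trans (val-lastBag wf (adjoin-⊑ u (a ∷ [])) (placed ready z∈)) (agrees ready z∈))
          (≤-trans (+-monoʳ-≤ (length S) (m≤n+m (size θ) 2)) (fits ready))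

  -- Each step of the closure gets a bag of its own; intermediate tuples are fresh copies,
  -- the last step reuses the copies of y.
  module Closure {k : ℕ} {χ : Form σ} {v w x y : Vec Var (suc k)} {uq : Unique (toList (v ++ w))}
                 (unfold : Unfolder χ) where
    open Walks {k = k} {χ = χ} {v = v} {w = w}

    θ : Form σ
    θ = tc k χ v w x y uq

    body : List Var
    body = fv χ ∖ toList (v ++ w)

    source : toList x ⊆ fv θ
    source = ∈-++⁺ˡ

    target : toList y ⊆ fv θ
    target = ∈-++⁺ʳ (toList x) ∘ ∈-++⁺ˡ

    body⊆ : body ⊆ fv θ
    body⊆ = ∈-++⁺ʳ (toList x) ∘ ∈-++⁺ʳ (toList y)

    spine : List ℕ → (Var → ℕ) → List ℕ
    spine S J = S L.++ L.map J (toList x L.++ toList y)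

    frame-spine : ∀ S J → frame S J θ ≡ spine S J L.++ L.map J body
    frame-spine S J = begin
      S L.++ L.map J (toList x L.++ toList y L.++ body)
        ≡⟨ cong (λ zs → S L.++ L.map J zs) (LP.++-assoc (toList x) _ body) ⟨
      S L.++ L.map J ((toList x L.++ toList y) L.++ body)
        ≡⟨ cong (S L.++_) (LP.map-++ J (toList x L.++ toList y) body) ⟩
      S L.++ (L.map J (toList x L.++ toList y) L.++ L.map J body)
        ≡⟨ LP.++-assoc S _ _ ⟨
      spine S J L.++ L.map J body
        ∎
      where open ≡-Reasoning

    length-spine : ∀ S J (E : Vec ℕ (suc k)) →
                   length (spine S J L.++ toList E) ≡ length S + (suc k + suc k) + suc k
    length-spine S J E = begin
      length (spine S J L.++ toList E)
        ≡⟨ LP.length-++ (spine S J) ⟩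
      length (spine S J) + length (toList E)
        ≡⟨ cong₂ _+_ (LP.length-++ S) (VP.length-toList E) ⟩
      length S + length (L.map J (toList x L.++ toList y)) + suc k
        ≡⟨ cong (λ n → length S + n + suc k) (LP.length-map J (toList x L.++ toList y)) ⟩
      length S + length (toList x L.++ toList y) + suc k
        ≡⟨ cong (λ n → length S + n + suc k) (LP.length-++ (toList x)) ⟩
      length S + (length (toList x) + length (toList y)) + suc k
        ≡⟨ cong (λ n → length S + n + suc k) (cong₂ _+_ (VP.length-toList x) (VP.length-toList y)) ⟩
      length S + (suc k + suc k) + suc k
        ∎
      where open ≡-Reasoning

    fits-link : ∀ S J (E : Vec ℕ (suc k)) → length S + size θ ≤ suc width →
                length (spine S J L.++ toList E) + size χ ≤ suc width
    fits-link S J E fits′ = begin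
      length (spine S J L.++ toList E) + size χ
        ≡⟨ cong (_+ size χ) (length-spine S J E) ⟩
      length S + (suc k + suc k) + suc k + size χ
        ≤⟨ ≤-trans (m≤m+n _ (3 + suc k)) (≤-reflexive (three-tuples (length S) (suc k) (size χ))) ⟩
      length S + size θ
        ≤⟨ fits′ ⟩
      suc width
        ∎
      where
      open ≤-Reasoning
      three-tuples : ∀ s K c → s + (K + K) + K + c + (3 + K) ≡ s + (3 + c + 4 * K)
      three-tuples = solve-∀

    link : ∀ {I u J S b b′} (E E′ : Vec ℕ (suc k)) → Sat 𝔄 (update I (v ++ w) (b ++ b′)) χ →
           WellFormed u → Ready u I J S θ → map (val u) E ≡ b → toList E ⊆ lastBag u →
           map (val u) E′ ≡ b′ → (∀ {e} → e ∈ toList E′ → Admissible u e) →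
           Grown u (frame S J θ L.++ toList E′) (λ r → Forces r (update J (v ++ w) (E ++ E′)) χ)
    link {I} {u} {J} {S} E E′ sat wf ready E-val E⊆ E′-val E′-admissible =
      Grown-map reframe id
        (descend unfold (v ++ w) (E ++ E′) sat wf (trans (VP.map-++ (val u) E E′) (cong₂ _++_ E-val E′-val))
           stack new outside (fits-link S J E′ (fits ready)))
      where
      J′ = update J (v ++ w) (E ++ E′)
      spine⊆ : spine S J ⊆ lastBag u
      spine⊆ = framed ready ∘ subst (_ ∈_) (sym (frame-spine S J)) ∘ ∈-++⁺ˡ
      stack : ∀ {e} → e ∈ spine S J L.++ toList E′ → e ∈ lastBag u ⊎ e ∈ toList (E ++ E′)
      stack = Sum.map spine⊆ (subst (_ ∈_) (sym (VP.toList-++ E E′)) ∘ ∈-++⁺ʳ (toList E))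
            ∘ ∈-++⁻ (spine S J)
      new : ∀ {e} → e ∈ toList (E ++ E′) → Admissible u e
      new = [ lastBag-admissible wf ∘ E⊆ , E′-admissible ]′
          ∘ ∈-++⁻ (toList E) ∘ subst (_ ∈_) (VP.toList-++ E E′)
      outside : ∀ {z} → z ∈ body → J z ∈ lastBag u × val u (J z) ≡ I z
      outside z∈ = placed ready (body⊆ z∈) , agrees ready (body⊆ z∈)
      reframe : frame S J θ L.++ toList E′ ⊆ frame (spine S J L.++ toList E′) J′ χ
      reframe e∈ with ∈-++⁻ (frame S J θ) e∈
      ... | inj₂ e∈E′ = ∈-++⁺ˡ (∈-++⁺ʳ (spine S J) e∈E′)
      ... | inj₁ e∈frame with ∈-++⁻ (spine S J) (subst (_ ∈_) (frame-spine S J) e∈frame)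
      ...   | inj₁ e∈spine = ∈-++⁺ˡ (∈-++⁺ˡ e∈spine)
      ...   | inj₂ e∈body =
        ∈-++⁺ʳ (spine S J L.++ toList E′) (map-∖-⊆-update J (v ++ w) (E ++ E′) (fv χ) e∈body)

    Forces-link : ∀ {r J} (E E′ : Vec ℕ (suc k)) → Forces r (update J (v ++ w) (E ++ E′)) χ →
                  ∀ {ℌ f} → Respects r ℌ f → Sat ℌ (update (f ∘ J) (v ++ w) (map f E ++ map f E′)) χ
    Forces-link {J = J} E E′ forces {ℌ} {f} resp =
      subst (λ bs → Sat ℌ (update (f ∘ J) (v ++ w) bs) χ) (VP.map-++ f E E′)
        (Forces-update {J = J} {χ} (v ++ w) (E ++ E′) forces resp)

    WalksTo : (Var → ℕ) → Vec ℕ (suc k) → Unfolding → Set₁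
    WalksTo J E r = ∀ ℌ f → Respects r ℌ f → Walk ℌ (f ∘ J) χ v w (map f E) (map (f ∘ J) y)

    chain : ∀ {I u J S} (d : ℕ) (a : ℕ → Vec (U 𝔄) (suc k)) → a (suc d) ≡ map I y →
            (∀ i → i < suc d → Sat 𝔄 (update I (v ++ w) (a i ++ a (suc i))) χ) →
            WellFormed u → Ready u I J S θ →
            (E : Vec ℕ (suc k)) → map (val u) E ≡ a 0 → toList E ⊆ lastBag u →
            Grown u (frame S J θ) (WalksTo J E)
    chain {I} {u} {J} zero a end steps wf ready E E-val E⊆ =
      Grown-map ∈-++⁺ˡ
        (λ forces ℌ f resp → walk-step (Forces-link E (map J y) forces resp) (walk-here (sym (VP.map-∘ f J y))))
        (link E (map J y) (steps 0 (s≤s z≤n)) wf ready E-val E⊆ (trans (agrees-tuple ready y target) (sym end))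
           (lastBag-admissible wf ∘ placed-tuple ready y target))
    chain {I} {u} {J} (suc d) a end steps wf ready E E-val E⊆ = record
      { result = result rest ; result-wf = result-wf rest
      ; extends = ⊑-trans (⊑-trans ext (extends g)) (extends rest)
      ; keeps = keeps rest
      ; ensures = λ ℌ f resp →
          walk-step (Forces-link E E′ (Forces-⊑ {θ = χ} (result-wf g) (extends rest) (ensures g)) resp)
                    (ensures rest ℌ f resp)
      }
      where
      ext = adjoin-⊑ u (a 1)
      E′ = newBlock u (a 1)
      ready′ = Ready-⊑ wf ext ready (framed ready)
      g = link E E′ (steps 0 (s≤s z≤n)) (adjoin-wf (a 1) wf) ready′
            (trans (map-agrees E (val-lastBag wf ext ∘ E⊆)) E-val) E⊆
            (newBlock-val u (a 1)) (newBlock-admissible wf (a 1))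
      E′-val : map (val (result g)) E′ ≡ a 1
      E′-val = trans (map-agrees E′ (val-≡ (extends g) ∘ proj₂ ∘ newBlock-admissible wf (a 1)))
                     (newBlock-val u (a 1))
      rest = chain d (a ∘ suc) end (λ i → steps (suc i) ∘ s≤s) (result-wf g)
               (Ready-⊑ (adjoin-wf (a 1) wf) (extends g) ready′ (keeps g ∘ ∈-++⁺ˡ))
               E′ E′-val (keeps g ∘ ∈-++⁺ʳ _)

    unfold-tc : Unfolder θ
    unfold-tc {I} {u} {J} (zero , a , a0 , an , _) wf ready = record
      { result = assume u ps ; result-wf = assume-wf wf sound ; extends = assume-⊑ u ps ; keeps = framed ready
      ; ensures = λ ℌ f resp → walk-here (begin
          map (f ∘ J) x     ≡⟨ VP.map-∘ f J x ⟩
          map f (map J x)   ≡⟨ map-pairs f (map J x) (map J y) (identifies resp ∘ ∈-++⁺ˡ) ⟩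
          map f (map J y)   ≡⟨ VP.map-∘ f J y ⟨
          map (f ∘ J) y     ∎)
      }
      where
      open ≡-Reasoning
      ps = pairs (map J x) (map J y)
      val-x≡val-y : map (val u) (map J x) ≡ map (val u) (map J y)
      val-x≡val-y = begin
        map (val u) (map J x)   ≡⟨ agrees-tuple ready x source ⟩
        map I x                 ≡⟨ trans (sym a0) an ⟩
        map I y                 ≡⟨ agrees-tuple ready y target ⟨
        map (val u) (map J y)   ∎
      sound : ∀ {p q} → (p , q) ∈ ps → val u p ≡ val u q × p ∈ lastBag u × q ∈ lastBag u
      sound pq∈ = pairs-map (val u) _ _ val-x≡val-y pq∈ ,
                  Prod.map (placed-tuple ready x source) (placed-tuple ready y target) (∈-pairs⁻ _ _ pq∈)
    unfold-tc {I} {u} {J} (suc d , a , a0 , an , steps) wf ready =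
      Grown-map id
        (λ walks ℌ f resp → subst (λ b → Walk ℌ (f ∘ J) χ v w b (map (f ∘ J) y)) (sym (VP.map-∘ f J x))
                                  (walks ℌ f resp))
        (chain d a an steps wf ready (map J x) (trans (agrees-tuple ready x source) (sym a0))
           (placed-tuple ready x source))

  unfold : ∀ θ → Unfolder θ
  unfold (atom R xs) = unfold-atom R xs
  unfold (eq x y) = unfold-eq x y
  unfold (θ₁ ∨ᶠ θ₂) = unfold-∨ (unfold θ₁) (unfold θ₂)
  unfold (θ₁ ∧ᶠ θ₂) = unfold-∧ (unfold θ₁) (unfold θ₂)
  unfold (ex x θ) = unfold-ex x (unfold θ)
  unfold (tc k χ v w x y uq) = Closure.unfold-tc (unfold χ)

  -- Enforcing the pending equalities

  module Identify {u : Unfolding} (wf : WellFormed u) {e e′ : ℕ} {ps : List (ℕ × ℕ)}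
                  (eqs≡ : eqs u ≡ (e , e′) ∷ ps) where
    ρ : ℕ → ℕ
    ρ = redirect e′ e

    merged : Unfolding
    merged = record u { bag = L.map ρ ∘ bag u ; eqs = L.map (Prod.map ρ ρ) ps }

    private
      sound : val u e ≡ val u e′ × InBag u (e ∷ e′ ∷ [])
      sound = eqs-sound wf (subst ((e , e′) ∈_) (sym eqs≡) (here refl))

      e<fresh : e < fresh u
      e<fresh = let t , t≤ , ee′⊆ = proj₂ sound in bounded wf t≤ (ee′⊆ (here refl))

    val-ρ : ∀ t → val u (ρ t) ≡ val u t
    val-ρ t with redirect-cases e′ e t
    ... | inj₁ (refl , ρt≡e) = trans (cong (val u) ρt≡e) (proj₁ sound)
    ... | inj₂ (_ , ρt≡t)    = cong (val u) ρt≡t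

    map-val-ρ : (ts : Vec ℕ m) → map (val u) (map ρ ts) ≡ map (val u) ts
    map-val-ρ ts = trans (sym (VP.map-∘ (val u) ρ ts)) (VP.map-cong val-ρ ts)

    ρ-fresh : ∀ {t} → t < fresh u → ρ t < fresh u
    ρ-fresh {t} t< with redirect-cases e′ e t
    ... | inj₁ (_ , ρt≡e) = subst (_< fresh u) (sym ρt≡e) e<fresh
    ... | inj₂ (_ , ρt≡t) = subst (_< fresh u) (sym ρt≡t) t<

    InBag-ρ : {ts : Vec ℕ m} → InBag u ts → InBag merged (map ρ ts)
    InBag-ρ {ts = ts} (t , t≤ , ts⊆) = t , t≤ , map⁺ ρ ts⊆ ∘ subst (_ ∈_) (VP.toList-map ρ ts)

    merged-sound : ∀ {p q} → (p , q) ∈ eqs merged → val u p ≡ val u q × InBag merged (p ∷ q ∷ [])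
    merged-sound pq∈ with ∈-map⁻ (Prod.map ρ ρ) pq∈
    ... | (a , b) , ab∈ , refl with eqs-sound wf (subst ((a , b) ∈_) (sym eqs≡) (there ab∈))
    ...   | va≡vb , inBag = trans (val-ρ a) (trans va≡vb (sym (val-ρ b))) , InBag-ρ inBag

    merged-wf : WellFormed merged
    merged-wf = record
      { bounded = λ t≤ x∈ → let y , y∈ , x≡ρy = ∈-map⁻ ρ x∈ in
                  subst (_< fresh u) (sym x≡ρy) (ρ-fresh (bounded wf t≤ y∈))
      ; small = λ {t} t≤ → subst (_≤ suc width) (sym (LP.length-map ρ (bag u t))) (small wf t≤)
      ; connected = let t , t≤ , ee′⊆ = proj₂ sound in
                    connected-redirect (connected wf) t≤ (ee′⊆ (here refl)) (ee′⊆ (there (here refl)))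
      ; eqs-sound = merged-sound
      }

    merged-pulls : ∀ {ℌ f} → Respects merged ℌ f → Respects u ℌ (f ∘ ρ)
    merged-pulls {ℌ} {f} resp = record
      { hom = λ R ts (inBag , r) → subst (relᵁ ℌ R) (sym (VP.map-∘ f ρ ts))
                (hom resp R (map ρ ts) (InBag-ρ inBag , subst (relᵁ 𝔄 R) (sym (map-val-ρ ts)) r))
      ; identifies = identified ∘ subst (_ ∈_) eqs≡
      }
      where
      identified : ∀ {a b} → (a , b) ∈ (e , e′) ∷ ps → f (ρ a) ≡ f (ρ b)
      identified (here refl) = cong f (trans (redirect-target e′ e) (sym (redirect-source e′ e)))
      identified (there ab∈) = identifies resp (∈-map⁺ (Prod.map ρ ρ) ab∈)

  record Quotient (u : Unfolding) : Set₁ where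
    field
      target     : Unfolding
      target-wf  : WellFormed target
      no-eqs     : eqs target ≡ []
      proj       : ℕ → ℕ
      proj-fresh : ∀ {e} → e < fresh u → proj e < fresh target
      proj-val   : ∀ {e} → e < fresh u → val target (proj e) ≡ val u e
      pulls      : ∀ {ℌ f} → Respects target ℌ f → Respects u ℌ (f ∘ proj)
  open Quotient

  quotient-by : ∀ n u → length (eqs u) ≡ n → WellFormed u → Quotient u
  quotient-by n (mkUnfolding c h l B []) _ wf = record
    { target = _ ; target-wf = wf ; no-eqs = refl
    ; proj = id ; proj-fresh = id ; proj-val = λ _ → refl ; pulls = id
    }
  quotient-by (suc n) u@(mkUnfolding c h l B ((e , e′) ∷ ps)) len wf = record
    { target = target q ; target-wf = target-wf q ; no-eqs = no-eqs q
    ; proj = proj q ∘ ρ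
    ; proj-fresh = proj-fresh q ∘ ρ-fresh
    ; proj-val = λ {t} t< → trans (proj-val q (ρ-fresh t<)) (val-ρ t)
    ; pulls = merged-pulls ∘ pulls q
    }
    where
    open Identify {u} wf refl
    q = quotient-by n merged (trans (LP.length-map _ ps) (suc-injective len)) merged-wf

  quotient : ∀ u → WellFormed u → Quotient u
  quotient u = quotient-by (length (eqs u)) u refl

  Forces-quotient : ∀ {u J θ} (q : Quotient u) → Forces u J θ → Forces (target q) (proj q ∘ J) θ
  Forces-quotient q forces ℌ f = forces ℌ (f ∘ proj q) ∘ pulls q

  -- Merging removes elements from the bags, and variables outside fv φ never entered one.
  Covered : Unfolding → ℕ → Set
  Covered u e = ∃ λ t → t < suc (last u) × e ∈ bag u t

  covered? : ∀ u e → Dec (Covered u e)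
  covered? u e = anyUpTo? (λ t → e ∈? bag u t) (suc (last u))

  Covered-⊑ : ∀ {u u′ e} → u ⊑ u′ → Covered u e → Covered u′ e
  Covered-⊑ ext (t , t< , e∈) =
    t , s≤s (≤-trans (≤-pred t<) (last-≤ ext)) , subst (_ ∈_) (sym (bag-≡ ext (≤-pred t<))) e∈

  record Covering (u : Unfolding) (n : ℕ) : Set where
    field
      covering    : Unfolding
      covering-wf : WellFormed covering
      covering-⊒  : u ⊑ covering
      same-fresh  : fresh covering ≡ fresh u
      same-eqs    : eqs covering ≡ eqs u
      covers      : ∀ {e} → e < n → Covered covering e
  open Covering

  cover-next : ∀ {u n} → Covering u n → n < fresh u → Covering u (suc n)
  cover-next {n = n} c n< with covered? (covering c) n
  ... | yes n-covered = record
    { covering = covering c ; covering-wf = covering-wf c ; covering-⊒ = covering-⊒ c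
    ; same-fresh = same-fresh c ; same-eqs = same-eqs c
    ; covers = λ e<1+n → [ covers c , (λ { refl → n-covered }) ]′ (m≤n⇒m<n∨m≡n (≤-pred e<1+n))
    }
  ... | no n-uncovered = record
    { covering = push (covering c) (n ∷ [])
    ; covering-wf = push-wf (covering-wf c)
                      (λ { (here refl) → inj₂ n-fresh , subst (n <_) (sym (same-fresh c)) n< }) (s≤s z≤n)
    ; covering-⊒ = ⊑-trans (covering-⊒ c) (push-⊑ _ _)
    ; same-fresh = same-fresh c ; same-eqs = same-eqs c
    ; covers = λ e<1+n → [ Covered-⊑ (push-⊑ (covering c) (n ∷ [])) ∘ covers c , (λ { refl → n-placed }) ]′
                           (m≤n⇒m<n∨m≡n (≤-pred e<1+n))
    }
    where
    n-fresh : Fresh (covering c) n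
    n-fresh t≤ n∈ = n-uncovered (_ , s≤s t≤ , n∈)
    n-placed : Covered (push (covering c) (n ∷ [])) n
    n-placed = _ , ≤-refl , subst (n ∈_) (sym (push-lastBag (covering c) (n ∷ []))) (here refl)

  cover : ∀ n u → n ≤ fresh u → WellFormed u → Covering u n
  cover zero u _ wf = record
    { covering = u ; covering-wf = wf ; covering-⊒ = ⊑-refl
    ; same-fresh = refl ; same-eqs = refl ; covers = λ ()
    }
  cover (suc n) u n< wf = cover-next (cover n u (<⇒≤ n<) wf) n<

  -- The finite structure

  module Finite (u : Unfolding) (wf : WellFormed u) {{_ : NonZero (fresh u)}}
                (no-eqs : eqs u ≡ []) (covered : ∀ {e} → e < fresh u → Covered u e) where
    toFin : ℕ → Fin (fresh u)
    toFin e = e mod fresh u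

    toℕ-toFin : ∀ {e} → e < fresh u → toℕ (toFin e) ≡ e
    toℕ-toFin e< = trans (FP.toℕ-fromℕ< _) (m<n⇒m%n≡m e<)

    toFin-toℕ : ∀ i → toFin (toℕ i) ≡ i
    toFin-toℕ i = FP.toℕ-injective (toℕ-toFin (FP.toℕ<n i))

    value : Fin (fresh u) → U 𝔄
    value = val u ∘ toℕ

    finBag : ℕ → Subset (fresh u)
    finBag t = image toFin (bag u t)

    ∈-finBag⁺ : ∀ {t} i → toℕ i ∈ bag u t → i ∈ₛ finBag t
    ∈-finBag⁺ i i∈ = subst (_∈ₛ _) (toFin-toℕ i) (∈-image⁺ toFin i∈)

    ∈-finBag⁻ : ∀ {t} → t ≤ last u → ∀ i → i ∈ₛ finBag t → toℕ i ∈ bag u t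
    ∈-finBag⁻ {t} t≤ i i∈ with ∈-image⁻ toFin (bag u t) i∈
    ... | e , e∈ , refl = subst (_∈ bag u t) (sym (toℕ-toFin (bounded wf t≤ e∈))) e∈

    FinRel : Fin (suc (last u)) → (R : Sym σ) → Vec (Fin (fresh u)) (ar σ R) → Set
    FinRel i R us = VA.All (_∈ₛ finBag (toℕ i)) us × relᵁ 𝔄 R (map value us)

    𝔅 : FinStruct σ (fresh u)
    𝔅 R us = ∃ λ i → FinRel i R us

    decomposition : PathDecomposition 𝔅 (suc width)
    decomposition = record
      { len = last u
      ; bag = finBag ∘ toℕ
      ; brel = FinRel
      ; brel-in = λ _ _ _ → proj₁
      ; small = λ i → ≤-trans (∣image∣≤length toFin (bag u (toℕ i)))
                              (small wf (≤-pred (FP.toℕ<n i)))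
      ; cover = λ i → let t , t< , i∈ = covered (FP.toℕ<n i) in
          fromℕ< t< , ∈-finBag⁺ i (subst (λ t → toℕ i ∈ bag u t) (sym (FP.toℕ-fromℕ< t<)) i∈)
      ; union→ = λ _ _ → id
      ; union← = λ _ _ i r → i , r
      ; connect = λ a i j l a∈i a∈j i≤l l≤j →
          let j≤ = ≤-pred (FP.toℕ<n j) in
          ∈-finBag⁺ a (connected wf i≤l l≤j j≤ (∈-finBag⁻ (≤-trans i≤l (≤-trans l≤j j≤)) a a∈i)
                                               (∈-finBag⁻ j≤ a a∈j))
      }

    value-hom : IsHom (toStruct 𝔅) 𝔄 value
    value-hom R us (_ , _ , r) = r

    respects : Respects u (toStruct 𝔅) toFin
    respects = record
      { hom = λ R ts ((t , t≤ , ts⊆) , r) →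
          fromℕ< (s≤s t≤) ,
          subst (λ t′ → VA.All (_∈ₛ finBag t′) (map toFin ts)) (sym (FP.toℕ-fromℕ< (s≤s t≤)))
            (VAP.map⁺ (VAP.toList⁻ (LA.tabulate (∈-image⁺ toFin ∘ ts⊆)))) ,
          subst (relᵁ 𝔄 R) (trans (map-agrees ts (cong (val u) ∘ sym ∘ toℕ-toFin ∘ bounded wf t≤ ∘ ts⊆))
                                   (VP.map-∘ value toFin ts)) r
      ; identifies = λ ab∈ → case subst (_ ∈_) no-eqs ab∈ of λ ()
      }

  -- Element z < M is the copy of the value of the variable z, so unfolding starts from J = id.
  initial : ℕ → (Var → U 𝔄) → Form σ → Unfolding
  initial M I φ = mkUnfolding M I 0 (λ _ → fv φ) []

  record Normalised (I : Var → U 𝔄) (φ : Form σ) (M : ℕ) : Set₁ where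
    field
      base         : Unfolding
      base-wf      : WellFormed base
      base-eqs     : eqs base ≡ []
      base-covered : ∀ {e} → e < fresh base → Covered base e
      assign       : Var → ℕ
      forces       : Forces base assign φ
      assign-fresh : ∀ {z} → z < M → assign z < fresh base
      assign-val   : ∀ {z} → z < M → val base (assign z) ≡ I z

  normalise : ∀ {I φ} M → Sat 𝔄 I φ → (∀ {z} → z ∈ fv φ → z < M) → size φ ≤ suc width →
              Normalised I φ M
  normalise {I} {φ} M sat fv<M fits′ = record
    { base = covering c
    ; base-wf = covering-wf c
    ; base-eqs = trans (same-eqs c) (no-eqs q)
    ; base-covered = covers c ∘ subst (_ <_) (same-fresh c)
    ; assign = proj q
    ; forces = Forces-⊑ {θ = φ} (target-wf q) (covering-⊒ c) (Forces-quotient {J = id} {φ} q (ensures g))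
    ; assign-fresh = λ {z} z< → subst (proj q z <_) (sym (same-fresh c)) (proj-fresh q (unfolded z<))
    ; assign-val = λ z< → begin
        val (covering c) (proj q _)  ≡⟨ val-≡ (covering-⊒ c) (proj-fresh q (unfolded z<)) ⟩
        val (target q) (proj q _)    ≡⟨ proj-val q (unfolded z<) ⟩
        val (result g) _             ≡⟨ val-≡ (extends g) z< ⟩
        I _                          ∎
    }
    where
    open ≡-Reasoning
    u₀ = initial M I φ
    wf₀ : WellFormed u₀
    wf₀ = record
      { bounded = λ _ → fv<M ; small = λ _ → ≤-trans (length-fv≤size φ) fits′
      ; connected = λ _ _ _ _ e∈ → e∈ ; eqs-sound = λ () }
    ready₀ : Ready u₀ I id [] φ
    ready₀ = record { agrees = λ _ → refl ; framed = subst (_ ∈_) (LP.map-id (fv φ)) ; fits = fits′ }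
    g = unfold φ sat wf₀ ready₀
    unfolded : ∀ {z} → z < M → z < fresh (result g)
    unfolded z< = <-≤-trans z< (fresh-≤ (extends g))
    q = quotient (result g) (result-wf g)
    c = cover (fresh (target q)) (target q) ≤-refl (target-wf q)

record NarrowModel {σ} (𝔄 : Struct σ) (I : Var → U 𝔄) (φ : Form σ) (V : List Var) (w : ℕ) : Set₁ where
  field
    n         : ℕ
    𝔅         : FinStruct σ n
    J         : Var → Fin n
    satisfies : Sat (toStruct 𝔅) J φ
    h         : Fin n → U 𝔄
    h-hom     : IsHom (toStruct 𝔅) 𝔄 h
    h-agrees  : ∀ {z} → z ∈ V → h (J z) ≡ I z
    narrow    : PathwidthAtMost 𝔅 w

narrowModel : ∀ {σ} {𝔄 : Struct σ} {I φ} → Sat 𝔄 I φ → (V : List Var) →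
              NarrowModel 𝔄 I φ V (size φ ∸ 1)
narrowModel {𝔄 = 𝔄} {I} {φ} sat V = record
  { n = fresh base
  ; 𝔅 = 𝔅
  ; J = toFin ∘ assign
  ; satisfies = forces (toStruct 𝔅) toFin respects
  ; h = value
  ; h-hom = value-hom
  ; h-agrees = λ z∈ → let z< = bound (∈-++⁺ʳ (fv φ) z∈) in
      trans (cong (val base) (toℕ-toFin (assign-fresh z<))) (assign-val z<)
  ; narrow = decomposition
  }
  where
  open Construction 𝔄 (size φ ∸ 1)
  open Unfolding
  M = suc (max 0 (fv φ L.++ V))
  bound : ∀ {z} → z ∈ fv φ L.++ V → z < M
  bound z∈ = s≤s (LA.lookup (xs≤max 0 (fv φ L.++ V)) z∈)
  open Normalised (normalise {φ = φ} M sat (bound ∘ ∈-++⁺ˡ) (m≤n+m∸n (size φ) 1))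
  open Finite base base-wf {{>-nonZero (≤-<-trans z≤n (assign-fresh {0} (s≤s z≤n)))}} base-eqs base-covered

proposition20 : {σ : Signature} (φ ψ : Form σ) →
    (Σ (Struct σ) λ 𝔄 → Σ (Var → U 𝔄) λ I → Sat 𝔄 I φ × ¬ Sat 𝔄 I ψ) →
    Σ ℕ λ n → Σ (FinStruct σ n) λ 𝔅 → Σ (Var → Fin n) λ I →
      (Sat (toStruct 𝔅) I φ × ¬ Sat (toStruct 𝔅) I ψ) ×
      PathwidthAtMost 𝔅 (size φ ∸ 1)
proposition20 φ ψ (𝔄 , I , sat-φ , unsat-ψ) =
  n , 𝔅 , J , (satisfies , unsat-ψ ∘ Sat-hom h-hom ψ h-agrees) , narrow
  where open NarrowModel (narrowModel {φ = φ} sat-φ (fv ψ))
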